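{- Let $X$ be a connected cubic pregraph with vertex set $V(X)$ of size $\ell \ge 3$, and suppose there exist $n \in \mathbb{N}$ and a $\mathbb{Z}_{n/\ell}$-voltage pregraph $(X, \varphi)$ whose derived graph is a nut graph of order $n$. Then there exists a real matrix $B \in \mathbb{R}^{V(X) \times V(X)}$ with $|B| = A(X)$ such that the (right) null space of $B$ contains a vector all of whose entries are positive.
   Context: For a real matrix $B$, $|B|$ denotes the matrix of absolute values of its entries. A pregraph is a quadruple $X = (D, V; \mathrm{beg}, \mathrm{inv})$, where $D$ (darts) and $V \neq \varnothing$ (vertices) are disjoint finite sets, $\mathrm{beg}\colon D \to V$ assigns to each dart its initial vertex, and $\mathrm{inv}\colon D \to D$ is an involution assigning to each dart its inverse (semi-edges, loops and parallel edges are allowed). Its adjacency matrix $A(X) \in \mathbb{R}^{V \times V}$ has $(x,y)$-entry equal to the number of darts $a$ with $\mathrm{beg}\, a = x$ and $\mathrm{beg}(\mathrm{inv}\, a) = y$. $X$ is cubic if every row sum of $A(X)$ is $3$, and connected if the graph obtained by deleting semi-edges, loops and duplicate edges is connected. For a group $\Gamma$, a $\Gamma$-voltage pregraph is a pair $(X, \varphi)$ with $\varphi\colon D \to \Gamma$ satisfying $\varphi(\mathrm{inv}\, a) = \varphi(a)^{ -1}$. Its derived graph is the pregraph with vertex set $V \times \Gamma$, dart set $D \times \Gamma$, $\mathrm{beg}_1(a,\gamma) = (\mathrm{beg}\, a, \gamma)$ and $\mathrm{inv}_1(a,\gamma) = (\mathrm{inv}\, a, \varphi(a)\gamma)$. A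 nut graph is a simple graph with at least two vertices whose adjacency matrix has a one-dimensional null space spanned by a vector with no zero entries. -}

module Defs where

open import Data.Nat using (ℕ; zero; suc; _+_; _∸_; _≤_)
open import Data.Nat.DivMod using (_mod_)
open import Data.Fin using (Fin; toℕ)
open import Data.Product using (_×_; _,_; ∃; ∃-syntax; Σ)
open import Data.Product.Properties using (≡-dec)
open import Data.List using (List; length; filter; map; foldr; allFin; cartesianProduct)
open import Data.Nat.ListAction using (sum)
open import Data.Integer using (+_)
open import Data.Rational using (ℚ; 0ℚ; _<_; ∣_∣) renaming (_+_ to _+ℚ_; _*_ to _*ℚ_; _/_ to _/ℚ_)
open import Relation.Binary.PropositionalEquality using (_≡_; _≢_)
open import Relation.Binary.Definitions using (DecidableEquality)
open import Relation.Binary.Construct.Closure.ReflexiveTransitive using (Star)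
open import Relation.Nullary using (¬_)
open import Relation.Nullary.Decidable using (_×-dec_)
import Data.Fin.Properties as FinP

-- A pregraph with vertex type V and dart type D (finiteness is supplied
-- separately by listings of all vertices / all darts).
record Pregraph (V D : Set) : Set where
  field
    beg : D → V
    inv : D → D
open Pregraph public

IsInvolutive : {V D : Set} → Pregraph V D → Set
IsInvolutive X = ∀ a → inv X (inv X a) ≡ a

Adj : {V D : Set} → DecidableEquality V → List D → Pregraph V D → V → V → ℕ
Adj _≟_ Ds X x y =
  length (filter (λ a → (beg X a ≟ x) ×-dec (beg X (inv X a) ≟ y)) Ds)

AdjF : {ℓ d : ℕ} → Pregraph (Fin ℓ) (Fin d) → Fin ℓ → Fin ℓ → ℕ
AdjF {ℓ} {d} X = Adj FinP._≟_ (allFin d) X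

IsCubic : {ℓ d : ℕ} → Pregraph (Fin ℓ) (Fin d) → Set
IsCubic {ℓ} X = ∀ x → sum (map (AdjF X x) (allFin ℓ)) ≡ 3

-- x and y joined by an (actual) dart; loops/semi-edges/multiplicities
-- do not affect the reflexive-transitive closure.
Joined : {ℓ d : ℕ} → Pregraph (Fin ℓ) (Fin d) → Fin ℓ → Fin ℓ → Set
Joined {ℓ} {d} X x y = Σ (Fin d) λ a → (beg X a ≡ x) × (beg X (inv X a) ≡ y)

IsConnected : {ℓ d : ℕ} → Pregraph (Fin ℓ) (Fin d) → Set
IsConnected X = ∀ x y → Star (Joined X) x y

_⊕_ : {k : ℕ} → Fin (suc k) → Fin (suc k) → Fin (suc k)
_⊕_ {k} a b = (toℕ a + toℕ b) mod (suc k)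

⊖_ : {k : ℕ} → Fin (suc k) → Fin (suc k)
⊖_ {k} a = (suc k ∸ toℕ a) mod (suc k)

IsVoltage : {ℓ d k : ℕ} → Pregraph (Fin ℓ) (Fin d) → (Fin d → Fin (suc k)) → Set
IsVoltage X φ = ∀ a → φ (inv X a) ≡ ⊖ (φ a)

Derived : {ℓ d k : ℕ} → Pregraph (Fin ℓ) (Fin d) → (Fin d → Fin (suc k)) →
          Pregraph (Fin ℓ × Fin (suc k)) (Fin d × Fin (suc k))
beg (Derived X φ) (a , γ) = (beg X a , γ)
inv (Derived X φ) (a , γ) = (inv X a , φ a ⊕ γ)

sumℚ : List ℚ → ℚ
sumℚ = foldr _+ℚ_ 0ℚ

ℕ→ℚ : ℕ → ℚ
ℕ→ℚ n = (+ n) /ℚ 1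

InKernel : {V : Set} → List V → (V → V → ℚ) → (V → ℚ) → Set
InKernel Vs M v = ∀ x → sumℚ (map (λ y → M x y *ℚ v y) Vs) ≡ 0ℚ

-- Simple pregraph: no semi-edges, no loops, no parallel edges
IsSimple : {V D : Set} → DecidableEquality V → List D → Pregraph V D → Set
IsSimple _≟_ Ds X =
  (∀ a → inv X a ≢ a) × (∀ a → beg X a ≢ beg X (inv X a)) ×
  (∀ x y → Adj _≟_ Ds X x y ≤ 1)

IsNut : {V D : Set} → DecidableEquality V → List V → List D → Pregraph V D → Set
IsNut _≟_ Vs Ds X =
  IsSimple _≟_ Ds X × (2 ≤ length Vs) ×
  Σ (_ → ℚ) λ v →
    InKernel Vs (λ x y → ℕ→ℚ (Adj _≟_ Ds X x y)) v ×
    (∀ x → v x ≢ 0ℚ) ×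
    (∀ w → InKernel Vs (λ x y → ℕ→ℚ (Adj _≟_ Ds X x y)) w →
       Σ ℚ λ c → ∀ x → w x ≡ c *ℚ v x)

DerivedIsNut : {ℓ d k : ℕ} → Pregraph (Fin ℓ) (Fin d) → (Fin d → Fin (suc k)) → Set
DerivedIsNut {ℓ} {d} {k} X φ =
  IsNut (≡-dec FinP._≟_ FinP._≟_)
        (cartesianProduct (allFin ℓ) (allFin (suc k)))
        (cartesianProduct (allFin d) (allFin (suc k)))
        (Derived X φ)

{-# OPTIONS --safe #-}
-- The shift γ ↦ γ + 1 of the voltage coordinate commutes with the darts of the derived graph, so it
-- maps the nut vector v to a multiple c · v of itself. Hence v (y , j) = cʲ · w y with w = v (- , 0)
-- nowhere zero, and c ^ (k + 1) = 1 forces c = ±1 over ℚ. The kernel equation of the derived graph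
-- at (x , 0) then reads ∑ sₐ · w (end a) = 0, summed over the three darts a leaving x, with signs
-- sₐ = c ^ φ(a). Two darts from x to the same y cannot carry opposite signs: they would cancel and
-- force the remaining, nonzero, term to vanish. So B x y = sgn (w y) · ∑_{a : x → y} sₐ satisfies
-- ∣ B ∣ = A(X), and ∣ w ∣ is a positive vector in its kernel.

module Submission where

open import Defs
open import Data.Nat using (ℕ; zero; suc; _≤_; s≤s)
import Data.Nat as ℕ
import Data.Nat.Properties as ℕP
open import Data.Nat.DivMod using (_%_; _mod_; %-distribˡ-+; m%n%n≡m%n; n%n≡0)
open import Data.Nat.ListAction using (sum)
open import Data.Fin using (Fin; zero; toℕ)
import Data.Fin.Properties as FinP
open import Data.Product using (_×_; Σ; _,_; proj₁; proj₂; ∃-syntax; uncurry)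
open import Data.Product.Properties using (≡-dec)
open import Data.Sum using (_⊎_; inj₁; inj₂)
open import Data.Bool using (true; false; if_then_else_)
open import Data.Empty using (⊥)
open import Data.List using (List; []; _∷_; _++_; map; filter; length; allFin; cartesianProduct)
import Data.List.Properties as ListP
open import Data.List.Membership.Propositional using (_∈_)
open import Data.List.Membership.Propositional.Properties
  using (∈-filter⁺; ∈-filter⁻; ∈-allFin; ∈-cartesianProduct⁺; ∈-∃++)
open import Data.List.Relation.Unary.Any using (here; there)
open import Data.List.Relation.Unary.All as All using (All; []; _∷_)
open import Data.List.Relation.Unary.AllPairs using ([]; _∷_)
open import Data.List.Relation.Unary.Unique.Propositional using (Unique)
open import Data.List.Relation.Unary.Unique.Propositional.Properties using (allFin⁺; cartesianProduct⁺)
open import Data.List.Relation.Binary.Permutation.Propositional using (_↭_; ↭-prep; ↭-trans; ↭-sym; ↭⇒↭ₛ)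
open import Data.List.Relation.Binary.Permutation.Propositional.Properties
  using (↭-length; ∈-resp-↭; map⁺) renaming (shift to ↭-shift)
open import Data.List.Relation.Binary.Permutation.Setoid.Properties using (foldr-commMonoid)
import Data.Integer as ℤ
import Data.Integer.Properties as ℤP
import Data.Rational as ℚ
open import Data.Rational
  using (ℚ; 0ℚ; 1ℚ; _+_; _*_; -_; ∣_∣; _<_; 1/_; toℚᵘ; ≢-nonZero; +-*-rawSemiring)
import Data.Rational.Properties as QP
import Data.Rational.Unnormalised as ℚᵘ
import Data.Rational.Unnormalised.Properties as ℚᵘP
open import Algebra.Definitions.RawSemiring +-*-rawSemiring using (_^_)
open import Algebra.Bundles using (CommutativeMonoid)
open import Algebra.Properties.CommutativeSemigroup
  (CommutativeMonoid.commutativeSemigroup QP.+-0-commutativeMonoid)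
  using () renaming (interchange to +-interchange)
open import Algebra.Properties.Ring QP.+-*-ring using (-1*x≈-x; -‿involutive)
open import Function using (_∘_; _⇔_; mk⇔)
open import Relation.Nullary using (Dec; yes; no; does; ¬_; contradiction)
open import Relation.Nullary.Decidable using (_×-dec_; dec-true; dec-false; does-⇔)
open import Relation.Binary.Definitions using (DecidableEquality; tri<; tri≈; tri>)
open import Relation.Binary.PropositionalEquality
  using (_≡_; _≢_; refl; sym; trans; cong; cong₂; subst; setoid; module ≡-Reasoning)

open ≡-Reasoning

private variable A A′ : Set

-- ℕ→ℚ n is definitionally fromℚᵘ (ℕ→ℚᵘ n), so arithmetic on it can be done in ℚᵘ.
ℕ→ℚᵘ : ℕ → ℚᵘ.ℚᵘ
ℕ→ℚᵘ n = ℚᵘ.mkℚᵘ (ℤ.+ n) 0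

ℕ→ℚ-+ : ∀ m n → ℕ→ℚ (m ℕ.+ n) ≡ ℕ→ℚ m + ℕ→ℚ n
ℕ→ℚ-+ m n = QP.toℚᵘ-injective (begin-≃
  toℚᵘ (ℕ→ℚ (m ℕ.+ n))           ≈⟨ QP.toℚᵘ-fromℚᵘ (ℕ→ℚᵘ (m ℕ.+ n)) ⟩
  ℕ→ℚᵘ (m ℕ.+ n)                 ≈⟨ ℚᵘ.*≡* (cong (ℤ._* ℤ.+ 1) numerators) ⟩
  ℕ→ℚᵘ m ℚᵘ.+ ℕ→ℚᵘ n             ≈⟨ ℚᵘP.+-cong (QP.toℚᵘ-fromℚᵘ (ℕ→ℚᵘ m)) (QP.toℚᵘ-fromℚᵘ (ℕ→ℚᵘ n)) ⟨
  toℚᵘ (ℕ→ℚ m) ℚᵘ.+ toℚᵘ (ℕ→ℚ n) ≈⟨ QP.toℚᵘ-homo-+ (ℕ→ℚ m) (ℕ→ℚ n) ⟨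
  toℚᵘ (ℕ→ℚ m + ℕ→ℚ n)           ∎≃)
  where
  open ℚᵘP.≃-Reasoning renaming (begin_ to begin-≃_; _∎ to _∎≃)
  numerators : ℤ.+ (m ℕ.+ n) ≡ ℤ.+ m ℤ.* ℤ.+ 1 ℤ.+ ℤ.+ n ℤ.* ℤ.+ 1
  numerators = trans (ℤP.pos-+ m n) (sym (cong₂ ℤ._+_ (ℤP.*-identityʳ (ℤ.+ m)) (ℤP.*-identityʳ (ℤ.+ n))))

ℕ→ℚ-injective : ∀ {m n} → ℕ→ℚ m ≡ ℕ→ℚ n → m ≡ n
ℕ→ℚ-injective {m} {n} eq with ℚᵘ.*≡* m≃n ← QP.fromℚᵘ-injective {ℕ→ℚᵘ m} {ℕ→ℚᵘ n} eq =
  ℤP.+-injective (trans (sym (ℤP.*-identityʳ (ℤ.+ m))) (trans m≃n (ℤP.*-identityʳ (ℤ.+ n))))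

∣ℕ→ℚ∣ : ∀ n → ∣ ℕ→ℚ n ∣ ≡ ℕ→ℚ n
∣ℕ→ℚ∣ n = QP.0≤p⇒∣p∣≡p (QP.nonNegative⁻¹ (ℕ→ℚ n) {{QP.normalize-nonNeg n 1}})

∑ : List A → (A → ℚ) → ℚ
∑ xs f = sumℚ (map f xs)

when : {P : Set} → Dec P → ℚ → ℚ
when P? q = if does P? then q else 0ℚ

∑-cong : ∀ (xs : List A) {f g : A → ℚ} → (∀ a → f a ≡ g a) → ∑ xs f ≡ ∑ xs g
∑-cong []       f≗g = refl
∑-cong (x ∷ xs) f≗g = cong₂ _+_ (f≗g x) (∑-cong xs f≗g)

∑-zero : ∀ (xs : List A) → ∑ xs (λ _ → 0ℚ) ≡ 0ℚ
∑-zero []       = refl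
∑-zero (x ∷ xs) = trans (QP.+-identityˡ _) (∑-zero xs)

∑-+ : ∀ (xs : List A) (f g : A → ℚ) → ∑ xs (λ a → f a + g a) ≡ ∑ xs f + ∑ xs g
∑-+ []       f g = refl
∑-+ (x ∷ xs) f g =
  trans (cong ((f x + g x) +_) (∑-+ xs f g)) (+-interchange (f x) (g x) (∑ xs f) (∑ xs g))

∑-*ʳ : ∀ (xs : List A) (f : A → ℚ) r → ∑ xs (λ a → f a * r) ≡ ∑ xs f * r
∑-*ʳ []       f r = sym (QP.*-zeroˡ r)
∑-*ʳ (x ∷ xs) f r = trans (cong (f x * r +_) (∑-*ʳ xs f r)) (sym (QP.*-distribʳ-+ r (f x) (∑ xs f)))

∑-++ : ∀ (xs ys : List A) (f : A → ℚ) → ∑ (xs ++ ys) f ≡ ∑ xs f + ∑ ys f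
∑-++ []       ys f = sym (QP.+-identityˡ _)
∑-++ (x ∷ xs) ys f = trans (cong (f x +_) (∑-++ xs ys f)) (sym (QP.+-assoc (f x) (∑ xs f) (∑ ys f)))

∑-map : (g : A′ → A) (xs : List A′) (f : A → ℚ) → ∑ (map g xs) f ≡ ∑ xs (f ∘ g)
∑-map g xs f = cong sumℚ (sym (ListP.map-∘ xs))

∑-↭ : ∀ (f : A → ℚ) {xs ys} → xs ↭ ys → ∑ xs f ≡ ∑ ys f
∑-↭ f xs↭ys = foldr-commMonoid (setoid ℚ) QP.+-0-isCommutativeMonoid (↭⇒↭ₛ (map⁺ f xs↭ys))

∑-constant : ∀ {xs : List A} {f : A → ℚ} {r} → (∀ {a} → a ∈ xs → f a ≡ r) → ∑ xs f ≡ ℕ→ℚ (length xs) * r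
∑-constant {xs = []}     {f} {r} _     = sym (QP.*-zeroˡ r)
∑-constant {xs = x ∷ xs} {f} {r} f≡r = begin
  f x + ∑ xs f                          ≡⟨ cong₂ _+_ (f≡r (here refl)) (∑-constant (f≡r ∘ there)) ⟩
  r + ℕ→ℚ (length xs) * r               ≡⟨ cong (_+ ℕ→ℚ (length xs) * r) (QP.*-identityˡ r) ⟨
  1ℚ * r + ℕ→ℚ (length xs) * r          ≡⟨ QP.*-distribʳ-+ r 1ℚ (ℕ→ℚ (length xs)) ⟨
  (1ℚ + ℕ→ℚ (length xs)) * r            ≡⟨ cong (_* r) (ℕ→ℚ-+ 1 (length xs)) ⟨
  ℕ→ℚ (length (x ∷ xs)) * r             ∎

ℕ→ℚ-sum : ∀ (xs : List A) (f : A → ℕ) → ℕ→ℚ (sum (map f xs)) ≡ ∑ xs (ℕ→ℚ ∘ f)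
ℕ→ℚ-sum []       f = refl
ℕ→ℚ-sum (x ∷ xs) f = trans (ℕ→ℚ-+ (f x) _) (cong (ℕ→ℚ (f x) +_) (ℕ→ℚ-sum xs f))

∑-swap : (xs : List A) (ys : List A′) (f : A → A′ → ℚ) →
  ∑ xs (λ a → ∑ ys (f a)) ≡ ∑ ys (λ b → ∑ xs (λ a → f a b))
∑-swap []       ys f = sym (∑-zero ys)
∑-swap (x ∷ xs) ys f =
  trans (cong (∑ ys (f x) +_) (∑-swap xs ys f)) (sym (∑-+ ys (f x) (λ b → ∑ xs (λ a → f a b))))

∑-cartesianProduct : (xs : List A) (ys : List A′) (f : A × A′ → ℚ) →
  ∑ (cartesianProduct xs ys) f ≡ ∑ xs (λ a → ∑ ys (λ b → f (a , b)))
∑-cartesianProduct []       ys f = refl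
∑-cartesianProduct (x ∷ xs) ys f = begin
  ∑ (map (x ,_) ys ++ cartesianProduct xs ys) f
    ≡⟨ ∑-++ (map (x ,_) ys) _ f ⟩
  ∑ (map (x ,_) ys) f + ∑ (cartesianProduct xs ys) f
    ≡⟨ cong₂ _+_ (∑-map (x ,_) ys f) (∑-cartesianProduct xs ys f) ⟩
  ∑ ys (λ b → f (x , b)) + ∑ xs (λ a → ∑ ys (λ b → f (a , b))) ∎

module _ {P : Set} where

  when-yes : (P? : Dec P) {q : ℚ} → P → when P? q ≡ q
  when-yes P? {q} p = cong (if_then q else 0ℚ) (dec-true P? p)

  when-no : (P? : Dec P) {q : ℚ} → ¬ P → when P? q ≡ 0ℚ
  when-no P? {q} ¬p = cong (if_then q else 0ℚ) (dec-false P? ¬p)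

  when-⇔ : ∀ {Q : Set} → P ⇔ Q → (P? : Dec P) (Q? : Dec Q) {q : ℚ} → when P? q ≡ when Q? q
  when-⇔ P⇔Q P? Q? {q} = cong (if_then q else 0ℚ) (does-⇔ P⇔Q P? Q?)

  when-× : ∀ {Q : Set} (P? : Dec P) (Q? : Dec Q) {q : ℚ} → when (P? ×-dec Q?) q ≡ when P? (when Q? q)
  when-× (yes _) Q? = refl
  when-× (no _)  Q? = refl

  ∑-when : (xs : List A) (P? : Dec P) (f : A → ℚ) → ∑ xs (λ a → when P? (f a)) ≡ when P? (∑ xs f)
  ∑-when xs (yes _) f = refl
  ∑-when xs (no _)  f = ∑-zero xs

∑-filter : {P : A → Set} (P? : ∀ a → Dec (P a)) (xs : List A) (f : A → ℚ) →
  ∑ (filter P? xs) f ≡ ∑ xs (λ a → when (P? a) (f a))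
∑-filter P? []       f = refl
∑-filter P? (x ∷ xs) f with does (P? x)
... | true  = cong (f x +_) (∑-filter P? xs f)
... | false = trans (∑-filter P? xs f) (sym (QP.+-identityˡ _))

module _ (_≟_ : DecidableEquality A) where

  ∑-when-absent : ∀ {e : A} {xs} (f : A → ℚ) → All (e ≢_) xs → ∑ xs (λ y → when (e ≟ y) (f y)) ≡ 0ℚ
  ∑-when-absent f []           = refl
  ∑-when-absent f (e≢x ∷ e∉xs) =
    trans (cong₂ _+_ (when-no (_ ≟ _) e≢x) (∑-when-absent f e∉xs)) (QP.+-identityˡ 0ℚ)

  ∑-sift : ∀ {e : A} {xs} (f : A → ℚ) → Unique xs → e ∈ xs → ∑ xs (λ y → when (e ≟ y) (f y)) ≡ f e
  ∑-sift {e} f (x∉xs ∷ _) (here refl) =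
    trans (cong₂ _+_ (when-yes (e ≟ e) refl) (∑-when-absent f x∉xs)) (QP.+-identityʳ (f e))
  ∑-sift {e} f (x∉xs ∷ xs!) (there e∈xs) =
    trans (cong₂ _+_ (when-no (e ≟ _) (λ { refl → All.lookup x∉xs e∈xs refl })) (∑-sift f xs! e∈xs))
          (QP.+-identityˡ (f e))

module Darts {V D : Set} (_≟_ : DecidableEquality V) (Ds : List D) (X : Pregraph V D) where

  end : D → V
  end a = beg X (inv X a)

  dartsFrom : V → List D
  dartsFrom x = filter (λ a → beg X a ≟ x) Ds

  darts : V → V → List D
  darts x y = filter (λ a → (beg X a ≟ x) ×-dec (end a ≟ y)) Ds

  ∈-darts⁻ : ∀ {a x y} → a ∈ darts x y → a ∈ dartsFrom x × end a ≡ y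
  ∈-darts⁻ {x = x} {y} a∈
    with a∈Ds , (beg≡x , end≡y) ← ∈-filter⁻ (λ a → (beg X a ≟ x) ×-dec (end a ≟ y)) {xs = Ds} a∈ =
    ∈-filter⁺ (λ a → beg X a ≟ x) {xs = Ds} a∈Ds beg≡x , end≡y

  module _ {Vs : List V} (Vs! : Unique Vs) (Vs-complete : ∀ y → y ∈ Vs) where

    ∑-fibres : ∀ x (H : D → V → ℚ) →
      ∑ Vs (λ y → ∑ (darts x y) (λ a → H a y)) ≡ ∑ (dartsFrom x) (λ a → H a (end a))
    ∑-fibres x H = begin
      ∑ Vs (λ y → ∑ (darts x y) (λ a → H a y))
        ≡⟨ ∑-cong Vs (λ y → ∑-filter _ Ds _) ⟩
      ∑ Vs (λ y → ∑ Ds (λ a → when ((beg X a ≟ x) ×-dec (end a ≟ y)) (H a y)))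
        ≡⟨ ∑-swap Vs Ds _ ⟩
      ∑ Ds (λ a → ∑ Vs (λ y → when ((beg X a ≟ x) ×-dec (end a ≟ y)) (H a y)))
        ≡⟨ ∑-cong Ds (λ a → trans (∑-cong Vs (λ y → when-× (beg X a ≟ x) (end a ≟ y))) (sift a)) ⟩
      ∑ Ds (λ a → when (beg X a ≟ x) (H a (end a)))
        ≡⟨ ∑-filter _ Ds _ ⟨
      ∑ (dartsFrom x) (λ a → H a (end a)) ∎
      where
      sift : ∀ a → ∑ Vs (λ y → when (beg X a ≟ x) (when (end a ≟ y) (H a y)))
                   ≡ when (beg X a ≟ x) (H a (end a))
      sift a = trans (∑-when Vs (beg X a ≟ x) _)
                     (cong (when (beg X a ≟ x)) (∑-sift _≟_ (H a) Vs! (Vs-complete (end a))))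

    Adj-row : ∀ x (f : V → ℚ) → ∑ Vs (λ y → ℕ→ℚ (Adj _≟_ Ds X x y) * f y) ≡ ∑ (dartsFrom x) (f ∘ end)
    Adj-row x f = begin
      ∑ Vs (λ y → ℕ→ℚ (Adj _≟_ Ds X x y) * f y)
        ≡⟨ ∑-cong Vs (λ y → ∑-constant {xs = darts x y} (λ _ → refl)) ⟨
      ∑ Vs (λ y → ∑ (darts x y) (λ _ → f y))
        ≡⟨ ∑-fibres x (λ _ → f) ⟩
      ∑ (dartsFrom x) (f ∘ end) ∎

IsSign : ℚ → Set
IsSign q = q ≡ 1ℚ ⊎ q ≡ - 1ℚ

∣sign∣≡1 : ∀ {p} → IsSign p → ∣ p ∣ ≡ 1ℚ
∣sign∣≡1 (inj₁ refl) = refl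
∣sign∣≡1 (inj₂ refl) = refl

IsSign-* : ∀ {p q} → IsSign p → IsSign q → IsSign (p * q)
IsSign-* (inj₁ refl) (inj₁ refl) = inj₁ refl
IsSign-* (inj₁ refl) (inj₂ refl) = inj₂ refl
IsSign-* (inj₂ refl) (inj₁ refl) = inj₂ refl
IsSign-* (inj₂ refl) (inj₂ refl) = inj₁ refl

IsSign-^ : ∀ {c} → IsSign c → ∀ j → IsSign (c ^ j)
IsSign-^ c± zero    = inj₁ refl
IsSign-^ c± (suc j) = IsSign-* c± (IsSign-^ c± j)

signs-equal-or-cancel : ∀ {p q} → IsSign p → IsSign q → p ≡ q ⊎ p + q ≡ 0ℚ
signs-equal-or-cancel (inj₁ refl) (inj₁ refl) = inj₁ refl
signs-equal-or-cancel (inj₁ refl) (inj₂ refl) = inj₂ refl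
signs-equal-or-cancel (inj₂ refl) (inj₁ refl) = inj₂ refl
signs-equal-or-cancel (inj₂ refl) (inj₂ refl) = inj₁ refl

∣sign*q∣ : ∀ {p} → IsSign p → ∀ q → ∣ p * q ∣ ≡ ∣ q ∣
∣sign*q∣ {p} p± q = begin
  ∣ p * q ∣       ≡⟨ QP.∣p*q∣≡∣p∣*∣q∣ p q ⟩
  ∣ p ∣ * ∣ q ∣   ≡⟨ cong (_* ∣ q ∣) (∣sign∣≡1 p±) ⟩
  1ℚ * ∣ q ∣      ≡⟨ QP.*-identityˡ ∣ q ∣ ⟩
  ∣ q ∣           ∎

sign*-≢0 : ∀ {p q} → IsSign p → q ≢ 0ℚ → p * q ≢ 0ℚ
sign*-≢0 {p} {q} p± q≢0 pq≡0 = q≢0 (QP.∣p∣≡0⇒p≡0 q (trans (sym (∣sign*q∣ p± q)) (cong ∣_∣ pq≡0)))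

∣q∣≡1⇒IsSign : ∀ {q} → ∣ q ∣ ≡ 1ℚ → IsSign q
∣q∣≡1⇒IsSign {q} ∣q∣≡1 with QP.∣p∣≡p∨∣p∣≡-p q
... | inj₁ ∣q∣≡q  = inj₁ (trans (sym ∣q∣≡q) ∣q∣≡1)
... | inj₂ ∣q∣≡-q = inj₂ (trans (sym (-‿involutive q)) (cong -_ (trans (sym ∣q∣≡-q) ∣q∣≡1)))

sgn : ℚ → ℚ
sgn q = if does (0ℚ QP.≤? q) then 1ℚ else - 1ℚ

sgn-IsSign : ∀ q → IsSign (sgn q)
sgn-IsSign q with does (0ℚ QP.≤? q)
... | true  = inj₁ refl
... | false = inj₂ refl

sgn*∣q∣ : ∀ q → sgn q * ∣ q ∣ ≡ q
sgn*∣q∣ q = by-cases (0ℚ QP.≤? q)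
  where
  by-cases : (0≤q? : Dec (0ℚ ℚ.≤ q)) → (if does 0≤q? then 1ℚ else - 1ℚ) * ∣ q ∣ ≡ q
  by-cases (yes 0≤q) = trans (QP.*-identityˡ ∣ q ∣) (QP.0≤p⇒∣p∣≡p 0≤q)
  by-cases (no 0≰q) with QP.∣p∣≡p∨∣p∣≡-p q
  ... | inj₁ ∣q∣≡q  = contradiction (QP.∣p∣≡p⇒0≤p ∣q∣≡q) 0≰q
  ... | inj₂ ∣q∣≡-q = begin
    - 1ℚ * ∣ q ∣   ≡⟨ -1*x≈-x ∣ q ∣ ⟩
    - ∣ q ∣        ≡⟨ cong -_ ∣q∣≡-q ⟩
    - (- q)        ≡⟨ -‿involutive q ⟩
    q              ∎

0<∣q∣ : ∀ {q} → q ≢ 0ℚ → 0ℚ < ∣ q ∣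
0<∣q∣ {q} q≢0 with QP.<-cmp 0ℚ ∣ q ∣
... | tri< 0<∣q∣ _ _ = 0<∣q∣
... | tri≈ _ 0≡∣q∣ _ = contradiction (QP.∣p∣≡0⇒p≡0 q (sym 0≡∣q∣)) q≢0
... | tri> _ _ ∣q∣<0 = contradiction (QP.≤-<-trans (QP.0≤∣p∣ q) ∣q∣<0) (QP.<-irrefl refl)

*-cancelʳ : ∀ {p q r} → r ≢ 0ℚ → p * r ≡ q * r → p ≡ q
*-cancelʳ {p} {q} {r} r≢0 pr≡qr = begin
  p              ≡⟨ undo p ⟨
  p * r * 1/ r   ≡⟨ cong (_* 1/ r) pr≡qr ⟩
  q * r * 1/ r   ≡⟨ undo q ⟩
  q              ∎
  where
  instance
    r≢0′ : ℚ.NonZero r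
    r≢0′ = ≢-nonZero r≢0
  undo : ∀ x → x * r * 1/ r ≡ x
  undo x = trans (QP.*-assoc x r (1/ r)) (trans (cong (x *_) (QP.*-inverseʳ r)) (QP.*-identityʳ x))

∣^∣ : ∀ c j → ∣ c ^ j ∣ ≡ ∣ c ∣ ^ j
∣^∣ c zero    = refl
∣^∣ c (suc j) = trans (QP.∣p*q∣≡∣p∣*∣q∣ c (c ^ j)) (cong (∣ c ∣ *_) (∣^∣ c j))

^-<1 : ∀ {a} → 0ℚ ℚ.≤ a → a < 1ℚ → ∀ j → a ^ suc j < 1ℚ
^-<1 {a} 0≤a a<1 zero    = subst (_< 1ℚ) (sym (QP.*-identityʳ a)) a<1
^-<1 {a} 0≤a a<1 (suc j) = QP.≤-<-trans a*aʲ≤a a<1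
  where
  a*aʲ≤a : a * a ^ suc j ℚ.≤ a
  a*aʲ≤a = subst (a * a ^ suc j ℚ.≤_) (QP.*-identityʳ a)
             (QP.*-monoˡ-≤-nonNeg a {{ℚ.nonNegative 0≤a}} (QP.<⇒≤ (^-<1 0≤a a<1 j)))

^->1 : ∀ {a} → 0ℚ ℚ.≤ a → 1ℚ < a → ∀ j → 1ℚ < a ^ suc j
^->1 {a} 0≤a 1<a zero    = subst (1ℚ <_) (sym (QP.*-identityʳ a)) 1<a
^->1 {a} 0≤a 1<a (suc j) = QP.<-≤-trans 1<a a≤a*aʲ
  where
  a≤a*aʲ : a ℚ.≤ a * a ^ suc j
  a≤a*aʲ = subst (ℚ._≤ a * a ^ suc j) (QP.*-identityʳ a)
             (QP.*-monoˡ-≤-nonNeg a {{ℚ.nonNegative 0≤a}} (QP.<⇒≤ (^->1 0≤a 1<a j)))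

nonNeg-root-of-unity : ∀ {a} k → 0ℚ ℚ.≤ a → a ^ suc k ≡ 1ℚ → a ≡ 1ℚ
nonNeg-root-of-unity k 0≤a aᵏ≡1 with QP.<-cmp _ 1ℚ
... | tri< a<1 _ _ = contradiction aᵏ≡1 (QP.<⇒≢ (^-<1 0≤a a<1 k))
... | tri≈ _ a≡1 _ = a≡1
... | tri> _ _ 1<a = contradiction (sym aᵏ≡1) (QP.<⇒≢ (^->1 0≤a 1<a k))

root-of-unity-IsSign : ∀ {c} k → c ^ suc k ≡ 1ℚ → IsSign c
root-of-unity-IsSign {c} k cᵏ≡1 =
  ∣q∣≡1⇒IsSign (nonNeg-root-of-unity k (QP.0≤∣p∣ c) (trans (sym (∣^∣ c (suc k))) (cong ∣_∣ cᵏ≡1)))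

∈⇒↭∷ : ∀ {x : A} {xs} → x ∈ xs → ∃[ ys ] xs ↭ x ∷ ys
∈⇒↭∷ x∈xs with ys , zs , refl ← ∈-∃++ x∈xs = ys ++ zs , ↭-shift _ ys zs

∈⇒↭∷∷ : ∀ {a b : A} {xs} → a ∈ xs → b ∈ xs → a ≢ b → ∃[ zs ] xs ↭ a ∷ b ∷ zs
∈⇒↭∷∷ {a = a} a∈xs b∈xs a≢b with ys , xs↭a∷ys ← ∈⇒↭∷ a∈xs with ∈-resp-↭ xs↭a∷ys b∈xs
... | here b≡a    = contradiction (sym b≡a) a≢b
... | there b∈ys with zs , ys↭b∷zs ← ∈⇒↭∷ b∈ys = zs , ↭-trans xs↭a∷ys (↭-prep a ys↭b∷zs)

no-cancelling-pair : ∀ (G : A → ℚ) {xs} → length xs ≡ 3 → ∑ xs G ≡ 0ℚ → (∀ {r} → r ∈ xs → G r ≢ 0ℚ) →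
  ∀ {a b} → a ∈ xs → b ∈ xs → a ≢ b → G a + G b ≢ 0ℚ
no-cancelling-pair G {xs} len ∑≡0 G≢0 {a} {b} a∈xs b∈xs a≢b Ga+Gb≡0 =
  uncurry leftover (∈⇒↭∷∷ a∈xs b∈xs a≢b)
  where
  leftover : ∀ zs → xs ↭ a ∷ b ∷ zs → ⊥
  leftover (r ∷ []) xs↭ = G≢0 (∈-resp-↭ (↭-sym xs↭) (there (there (here refl)))) (begin
    G r                    ≡⟨ QP.+-identityˡ (G r) ⟨
    0ℚ + G r               ≡⟨ cong (_+ G r) Ga+Gb≡0 ⟨
    G a + G b + G r        ≡⟨ QP.+-assoc (G a) (G b) (G r) ⟩
    G a + (G b + G r)      ≡⟨ cong (λ t → G a + (G b + t)) (QP.+-identityʳ (G r)) ⟨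
    ∑ (a ∷ b ∷ r ∷ []) G   ≡⟨ ∑-↭ G xs↭ ⟨
    ∑ xs G                 ≡⟨ ∑≡0 ⟩
    0ℚ                     ∎)
  leftover []          xs↭ with () ← trans (sym len) (↭-length xs↭)
  leftover (_ ∷ _ ∷ _) xs↭ with () ← trans (sym len) (↭-length xs↭)

∣∑∣-same-sign : ∀ {xs : List A} {s : A → ℚ} → (∀ a → IsSign (s a)) → (∀ {a b} → a ∈ xs → b ∈ xs → s a ≡ s b) →
  ∣ ∑ xs s ∣ ≡ ℕ→ℚ (length xs)
∣∑∣-same-sign {xs = []}     s± same = refl
∣∑∣-same-sign {xs = a ∷ as} {s} s± same = begin
  ∣ ∑ (a ∷ as) s ∣                  ≡⟨ cong ∣_∣ (∑-constant {xs = a ∷ as} (λ b∈ → same b∈ (here refl))) ⟩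
  ∣ ℕ→ℚ (length (a ∷ as)) * s a ∣   ≡⟨ cong ∣_∣ (QP.*-comm _ (s a)) ⟩
  ∣ s a * ℕ→ℚ (length (a ∷ as)) ∣   ≡⟨ ∣sign*q∣ (s± a) (ℕ→ℚ (length (a ∷ as))) ⟩
  ∣ ℕ→ℚ (length (a ∷ as)) ∣         ≡⟨ ∣ℕ→ℚ∣ (length (a ∷ as)) ⟩
  ℕ→ℚ (length (a ∷ as))             ∎

module BaseGraph {ℓ d : ℕ} (X : Pregraph (Fin ℓ) (Fin d)) where

  open Darts FinP._≟_ (allFin d) X public

  cubic⇒degree≡3 : IsCubic X → ∀ x → length (dartsFrom x) ≡ 3
  cubic⇒degree≡3 cubic x = ℕ→ℚ-injective (begin
    ℕ→ℚ (length (dartsFrom x))                    ≡⟨ QP.*-identityʳ _ ⟨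
    ℕ→ℚ (length (dartsFrom x)) * 1ℚ               ≡⟨ ∑-constant {xs = dartsFrom x} (λ _ → refl) ⟨
    ∑ (dartsFrom x) (λ _ → 1ℚ)                    ≡⟨ Adj-row (allFin⁺ ℓ) ∈-allFin x (λ _ → 1ℚ) ⟨
    ∑ (allFin ℓ) (λ y → ℕ→ℚ (AdjF X x y) * 1ℚ)    ≡⟨ ∑-cong (allFin ℓ) (λ y → QP.*-identityʳ _) ⟩
    ∑ (allFin ℓ) (λ y → ℕ→ℚ (AdjF X x y))         ≡⟨ ℕ→ℚ-sum (allFin ℓ) (AdjF X x) ⟨
    ℕ→ℚ (sum (map (AdjF X x) (allFin ℓ)))         ≡⟨ cong ℕ→ℚ (cubic x) ⟩
    ℕ→ℚ 3                                         ∎)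

  module Signing (cubic : IsCubic X) (s : Fin d → ℚ) (s± : ∀ a → IsSign (s a))
                 (w : Fin ℓ → ℚ) (w≢0 : ∀ y → w y ≢ 0ℚ)
                 (w-kernel : ∀ x → ∑ (dartsFrom x) (λ a → s a * w (end a)) ≡ 0ℚ) where

    parallel-darts-same-sign : ∀ {x y a b} → a ∈ darts x y → b ∈ darts x y → s a ≡ s b
    parallel-darts-same-sign {x} {y} {a} {b} a∈ b∈ with a FinP.≟ b | signs-equal-or-cancel (s± a) (s± b)
    ... | yes refl | _            = refl
    ... | no _     | inj₁ sa≡sb   = sa≡sb
    ... | no a≢b   | inj₂ sa+sb≡0 =
      contradiction cancel (no-cancelling-pair G (cubic⇒degree≡3 cubic x) (w-kernel x) (λ {r} _ → G≢0 r)
                                               (proj₁ (∈-darts⁻ a∈)) (proj₁ (∈-darts⁻ b∈)) a≢b)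
      where
      G : Fin d → ℚ
      G r = s r * w (end r)
      G≢0 : ∀ r → G r ≢ 0ℚ
      G≢0 r = sign*-≢0 (s± r) (w≢0 (end r))
      cancel : G a + G b ≡ 0ℚ
      cancel = begin
        s a * w (end a) + s b * w (end b) ≡⟨ cong₂ (λ u u′ → s a * w u + s b * w u′) end-a end-b ⟩
        s a * w y + s b * w y             ≡⟨ QP.*-distribʳ-+ (w y) (s a) (s b) ⟨
        (s a + s b) * w y                 ≡⟨ cong (_* w y) sa+sb≡0 ⟩
        0ℚ * w y                          ≡⟨ QP.*-zeroˡ (w y) ⟩
        0ℚ                                ∎
        where
        end-a : end a ≡ y
        end-a = proj₂ (∈-darts⁻ a∈)
        end-b : end b ≡ y
        end-b = proj₂ (∈-darts⁻ b∈)

    B : Fin ℓ → Fin ℓ → ℚ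
    B x y = ∑ (darts x y) s * sgn (w y)

    ∣B∣≡Adj : ∀ x y → ∣ B x y ∣ ≡ ℕ→ℚ (AdjF X x y)
    ∣B∣≡Adj x y = begin
      ∣ ∑ (darts x y) s * sgn (w y) ∣  ≡⟨ cong ∣_∣ (QP.*-comm _ (sgn (w y))) ⟩
      ∣ sgn (w y) * ∑ (darts x y) s ∣  ≡⟨ ∣sign*q∣ (sgn-IsSign (w y)) (∑ (darts x y) s) ⟩
      ∣ ∑ (darts x y) s ∣              ≡⟨ ∣∑∣-same-sign s± parallel-darts-same-sign ⟩
      ℕ→ℚ (AdjF X x y)                 ∎

    B∣w∣≡0 : InKernel (allFin ℓ) B (∣_∣ ∘ w)
    B∣w∣≡0 x = begin
      ∑ (allFin ℓ) (λ y → ∑ (darts x y) s * sgn (w y) * ∣ w y ∣) ≡⟨ ∑-cong (allFin ℓ) entry ⟩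
      ∑ (allFin ℓ) (λ y → ∑ (darts x y) (λ a → s a * w y))      ≡⟨ ∑-fibres (allFin⁺ ℓ) ∈-allFin x _ ⟩
      ∑ (dartsFrom x) (λ a → s a * w (end a))                    ≡⟨ w-kernel x ⟩
      0ℚ                                                         ∎
      where
      entry : ∀ y → ∑ (darts x y) s * sgn (w y) * ∣ w y ∣ ≡ ∑ (darts x y) (λ a → s a * w y)
      entry y = begin
        ∑ (darts x y) s * sgn (w y) * ∣ w y ∣    ≡⟨ QP.*-assoc (∑ (darts x y) s) (sgn (w y)) ∣ w y ∣ ⟩
        ∑ (darts x y) s * (sgn (w y) * ∣ w y ∣)  ≡⟨ cong (∑ (darts x y) s *_) (sgn*∣q∣ (w y)) ⟩
        ∑ (darts x y) s * w y                    ≡⟨ ∑-*ʳ (darts x y) s (w y) ⟨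
        ∑ (darts x y) (λ a → s a * w y)          ∎

module Cyclic (k : ℕ) where

  private
    M : ℕ
    M = suc k

  mod-cong : ∀ m n → m % M ≡ n % M → m mod M ≡ n mod M
  mod-cong m n eq = FinP.fromℕ<-cong (m % M) (n % M) eq _ _

  +-mod-absorbʳ : ∀ m n → (m ℕ.+ toℕ (n mod M)) mod M ≡ (m ℕ.+ n) mod M
  +-mod-absorbʳ m n = mod-cong (m ℕ.+ toℕ (n mod M)) (m ℕ.+ n) (begin
    (m ℕ.+ toℕ (n mod M)) % M      ≡⟨ cong (λ t → (m ℕ.+ t) % M) (FinP.toℕ-fromℕ< _) ⟩
    (m ℕ.+ n % M) % M              ≡⟨ %-distribˡ-+ m (n % M) M ⟩
    (m % M ℕ.+ n % M % M) % M      ≡⟨ cong (λ t → (m % M ℕ.+ t) % M) (m%n%n≡m%n n M) ⟩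
    (m % M ℕ.+ n % M) % M          ≡⟨ %-distribˡ-+ m n M ⟨
    (m ℕ.+ n) % M                  ∎)

  shift : Fin M → Fin M
  shift γ = suc (toℕ γ) mod M

  shift-⊕ : ∀ α γ → shift (α ⊕ γ) ≡ α ⊕ shift γ
  shift-⊕ α γ = begin
    shift (α ⊕ γ)                       ≡⟨ +-mod-absorbʳ 1 (toℕ α ℕ.+ toℕ γ) ⟩
    suc (toℕ α ℕ.+ toℕ γ) mod M         ≡⟨ cong (_mod M) (ℕP.+-suc (toℕ α) (toℕ γ)) ⟨
    (toℕ α ℕ.+ suc (toℕ γ)) mod M       ≡⟨ +-mod-absorbʳ (toℕ α) (suc (toℕ γ)) ⟨
    α ⊕ shift γ                         ∎

  shift-mod : ∀ j → shift (j mod M) ≡ suc j mod M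
  shift-mod = +-mod-absorbʳ 1

  M-mod : M mod M ≡ zero
  M-mod = mod-cong M 0 (n%n≡0 M)

  ⊕-zero : ∀ α → α ⊕ zero ≡ toℕ α mod M
  ⊕-zero α = cong (_mod M) (ℕP.+-identityʳ (toℕ α))

module Voltage {ℓ d k : ℕ} (X : Pregraph (Fin ℓ) (Fin d)) (φ : Fin d → Fin (suc k)) where

  open BaseGraph X public
  open Cyclic k public

  private
    _≟ᶜ_ : DecidableEquality (Fin ℓ × Fin (suc k))
    _≟ᶜ_ = ≡-dec FinP._≟_ FinP._≟_
    Vsᶜ : List (Fin ℓ × Fin (suc k))
    Vsᶜ = cartesianProduct (allFin ℓ) (allFin (suc k))
    Dsᶜ : List (Fin d × Fin (suc k))
    Dsᶜ = cartesianProduct (allFin d) (allFin (suc k))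
    module Cover = Darts _≟ᶜ_ Dsᶜ (Derived X φ)

  InCoverKernel : (Fin ℓ × Fin (suc k) → ℚ) → Set
  InCoverKernel = InKernel Vsᶜ (λ p q → ℕ→ℚ (Adj _≟ᶜ_ Dsᶜ (Derived X φ) p q))

  cover-row : ∀ (f : Fin ℓ × Fin (suc k) → ℚ) x γ →
    ∑ Vsᶜ (λ q → ℕ→ℚ (Adj _≟ᶜ_ Dsᶜ (Derived X φ) (x , γ) q) * f q)
      ≡ ∑ (dartsFrom x) (λ a → f (end a , φ a ⊕ γ))
  cover-row f x γ = begin
    ∑ Vsᶜ (λ q → ℕ→ℚ (Adj _≟ᶜ_ Dsᶜ (Derived X φ) (x , γ) q) * f q)
      ≡⟨ Cover.Adj-row (cartesianProduct⁺ (allFin⁺ ℓ) (allFin⁺ (suc k))) Vsᶜ-complete (x , γ) f ⟩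
    ∑ (Cover.dartsFrom (x , γ)) (f ∘ Cover.end)
      ≡⟨ ∑-filter _ Dsᶜ _ ⟩
    ∑ Dsᶜ (λ (a , ε) → when ((beg X a , ε) ≟ᶜ (x , γ)) (f (end a , φ a ⊕ ε)))
      ≡⟨ ∑-cartesianProduct (allFin d) (allFin (suc k)) _ ⟩
    ∑ (allFin d) (λ a → ∑ (allFin (suc k)) (λ ε → when ((beg X a , ε) ≟ᶜ (x , γ)) (f (end a , φ a ⊕ ε))))
      ≡⟨ ∑-cong (allFin d) (λ a → trans (∑-cong (allFin (suc k)) (λ ε → split a ε)) (sift a)) ⟩
    ∑ (allFin d) (λ a → when (beg X a FinP.≟ x) (f (end a , φ a ⊕ γ)))
      ≡⟨ ∑-filter _ (allFin d) _ ⟨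
    ∑ (dartsFrom x) (λ a → f (end a , φ a ⊕ γ)) ∎
    where
    Vsᶜ-complete : ∀ p → p ∈ Vsᶜ
    Vsᶜ-complete (y , δ) = ∈-cartesianProduct⁺ (∈-allFin y) (∈-allFin δ)
    split : ∀ a ε {q} → when ((beg X a , ε) ≟ᶜ (x , γ)) q ≡ when (beg X a FinP.≟ x) (when (γ FinP.≟ ε) q)
    split a ε = trans (when-⇔ (mk⇔ (λ { refl → refl , refl }) (λ { (refl , refl) → refl }))
                              ((beg X a , ε) ≟ᶜ (x , γ)) ((beg X a FinP.≟ x) ×-dec (γ FinP.≟ ε)))
                      (when-× (beg X a FinP.≟ x) (γ FinP.≟ ε))
    sift : ∀ a → ∑ (allFin (suc k)) (λ ε → when (beg X a FinP.≟ x) (when (γ FinP.≟ ε) (f (end a , φ a ⊕ ε))))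
                 ≡ when (beg X a FinP.≟ x) (f (end a , φ a ⊕ γ))
    sift a = trans (∑-when (allFin (suc k)) (beg X a FinP.≟ x) _)
                   (cong (when (beg X a FinP.≟ x)) (∑-sift FinP._≟_ _ (allFin⁺ (suc k)) (∈-allFin γ)))

  shiftᶜ : (Fin ℓ × Fin (suc k) → ℚ) → (Fin ℓ × Fin (suc k) → ℚ)
  shiftᶜ f (y , γ) = f (y , shift γ)

  shift-preserves-kernel : ∀ {f} → InCoverKernel f → InCoverKernel (shiftᶜ f)
  shift-preserves-kernel {f} f∈ker (x , γ) = begin
    ∑ Vsᶜ (λ q → ℕ→ℚ (Adj _≟ᶜ_ Dsᶜ (Derived X φ) (x , γ) q) * shiftᶜ f q)
      ≡⟨ cover-row (shiftᶜ f) x γ ⟩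
    ∑ (dartsFrom x) (λ a → f (end a , shift (φ a ⊕ γ)))
      ≡⟨ ∑-cong (dartsFrom x) (λ a → cong (λ δ → f (end a , δ)) (shift-⊕ (φ a) γ)) ⟩
    ∑ (dartsFrom x) (λ a → f (end a , φ a ⊕ shift γ))
      ≡⟨ cover-row f x (shift γ) ⟨
    ∑ Vsᶜ (λ q → ℕ→ℚ (Adj _≟ᶜ_ Dsᶜ (Derived X φ) (x , shift γ) q) * f q)
      ≡⟨ f∈ker (x , shift γ) ⟩
    0ℚ ∎

  module ShiftEigenvector (v : Fin ℓ × Fin (suc k) → ℚ) (c : ℚ)
                          (eigen : ∀ p → shiftᶜ v p ≡ c * v p) where

    w : Fin ℓ → ℚ
    w y = v (y , zero)

    v-pow : ∀ y j → v (y , j mod suc k) ≡ c ^ j * w y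
    v-pow y zero    = sym (QP.*-identityˡ (w y))
    v-pow y (suc j) = begin
      v (y , suc j mod suc k)    ≡⟨ cong (λ δ → v (y , δ)) (shift-mod j) ⟨
      v (y , shift (j mod suc k)) ≡⟨ eigen (y , j mod suc k) ⟩
      c * v (y , j mod suc k)    ≡⟨ cong (c *_) (v-pow y j) ⟩
      c * (c ^ j * w y)          ≡⟨ QP.*-assoc c (c ^ j) (w y) ⟨
      c ^ suc j * w y            ∎

    c-IsSign : ∀ y → w y ≢ 0ℚ → IsSign c
    c-IsSign y wy≢0 = root-of-unity-IsSign k (*-cancelʳ wy≢0 (begin
      c ^ suc k * w y            ≡⟨ v-pow y (suc k) ⟨
      v (y , suc k mod suc k)    ≡⟨ cong (λ δ → v (y , δ)) M-mod ⟩
      w y                        ≡⟨ QP.*-identityˡ (w y) ⟨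
      1ℚ * w y                   ∎))

    zero-fibre-kernel : InCoverKernel v → ∀ x → ∑ (dartsFrom x) (λ a → c ^ toℕ (φ a) * w (end a)) ≡ 0ℚ
    zero-fibre-kernel v∈ker x = begin
      ∑ (dartsFrom x) (λ a → c ^ toℕ (φ a) * w (end a)) ≡⟨ ∑-cong (dartsFrom x) v-on-dart ⟨
      ∑ (dartsFrom x) (λ a → v (end a , φ a ⊕ zero))     ≡⟨ cover-row v x zero ⟨
      _                                                  ≡⟨ v∈ker (x , zero) ⟩
      0ℚ                                                 ∎
      where
      v-on-dart : ∀ a → v (end a , φ a ⊕ zero) ≡ c ^ toℕ (φ a) * w (end a)
      v-on-dart a = trans (cong (λ δ → v (end a , δ)) (⊕-zero (φ a))) (v-pow (end a) (toℕ (φ a)))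

proposition7 : (ℓ d : ℕ) → 3 ≤ ℓ → (X : Pregraph (Fin ℓ) (Fin d)) →
    IsInvolutive X → IsCubic X → IsConnected X →
    (k : ℕ) → (φ : Fin d → Fin (suc k)) → IsVoltage X φ → DerivedIsNut X φ →
    Σ (Fin ℓ → Fin ℓ → ℚ) λ B →
      (∀ x y → ∣ B x y ∣ ≡ ℕ→ℚ (AdjF X x y)) ×
      Σ (Fin ℓ → ℚ) λ v → InKernel (allFin ℓ) B v × (∀ x → 0ℚ < v x)
proposition7 ℓ d (s≤s _) X _ cubic _ k φ _ (_ , _ , v , v∈ker , v≢0 , ker⊆span) =
  B , ∣B∣≡Adj , ∣_∣ ∘ w , B∣w∣≡0 , λ y → 0<∣q∣ (w≢0 y)
  where
  open Voltage X φ
  eigenpair : Σ ℚ λ c → ∀ p → shiftᶜ v p ≡ c * v p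
  eigenpair = ker⊆span (shiftᶜ v) (shift-preserves-kernel v∈ker)
  c : ℚ
  c = proj₁ eigenpair
  open ShiftEigenvector v c (proj₂ eigenpair)
  w≢0 : ∀ y → w y ≢ 0ℚ
  w≢0 y = v≢0 (y , zero)
  c± : IsSign c
  c± = c-IsSign zero (w≢0 zero)
  open Signing cubic (λ a → c ^ toℕ (φ a)) (λ a → IsSign-^ c± (toℕ (φ a))) w w≢0 (zero-fibre-kernel v∈ker)
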